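{- Let $\varphi$ be a 3SAT formula on variables $x_1,\dots,x_n$, and let $(X,\mathcal{F})$ be the Avoider-Enforcer game constructed from $\varphi$ as described in the context, played with Enforcer making the first move. Consider the restricted game in which the play is constrained so that, within each box $B_i$, the vertex $a_i$ is claimed before $x_i$ and $\overline{x_i}$, and $s_i$ is claimed after both $x_i$ and $\overline{x_i}$. Then the outcome of the restricted game (which player has a winning strategy) is the same as that of the unrestricted game.
   Context: Avoider-Enforcer game: on a hypergraph $(X,\mathcal{F})$, Avoider and Enforcer alternately claim one previously unclaimed vertex of $X$ per move until all vertices are claimed; Avoider loses if she has claimed all vertices of some losing set $f\in\mathcal{F}$, and wins otherwise. Construction from a 3SAT formula $\varphi$ on variables $x_1,\dots,x_n$, each clause having the form $C=\ell_i\lor\ell_j\lor\ell_k$ with $\ell_h\in\{x_h,\overline{x_h}\}$ for $h=i,j,k$: the board $X$ consists of $4n$ vertices partitioned into boxes $B_i=\{a_i,s_i,x_i,\overline{x_i}\}$, $i=1,\dots,n$ (the vertices $x_i,\overline{x_i}$ are identified with the corresponding literals). The losing sets are: for each $i$, all four $3$-element subsets of $B_i$; and for each clause $C=\ell_i\lor\ell_j\lor\ell_k$ of $\varphi$, the set $L_C=\{s_i,s_j,s_k,\overline{\ell_i},\overline{\ell_j},\overline{\ell_k}\}$, where $\overline{\ell}$ denotes the negation of literal $\ell$ (with $\overline{\overline{x_h}}=x_h$). -}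

module Defs where

open import Data.Nat using (ℕ)
open import Data.Fin using (Fin; _≟_)
open import Data.Bool using (Bool; true; false; if_then_else_)
open import Data.Product using (_×_; _,_; Σ)
open import Data.List using (List; []; _∷_; allFin; concatMap; _++_)
open import Data.List.Relation.Unary.All using (All)
open import Data.List.Relation.Unary.Any using (Any)
open import Relation.Binary.PropositionalEquality using (_≡_; _≢_; refl)
open import Relation.Nullary using (Dec; yes; no; ¬_)

-- A literal: variable index together with polarity (true = x_h, false = x̄_h).
Literal : ℕ → Set
Literal n = Fin n × Bool

var : ∀ {n} → Literal n → Fin n
var (h , _) = h

Clause : ℕ → Set
Clause n = Literal n × Literal n × Literal n

DistinctVars : ∀ {n} → Clause n → Set
DistinctVars (l₁ , l₂ , l₃) = var l₁ ≢ var l₂ × var l₁ ≢ var l₃ × var l₂ ≢ var l₃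

Formula : ℕ → Set
Formula n = List (Clause n)

-- The board: 4n vertices, box B_i = {a_i, s_i, x_i, x̄_i}

data Kind : Set where
  kA kS kX kX̄ : Kind

_≟K_ : (k l : Kind) → Dec (k ≡ l)
kA ≟K kA = yes refl
kA ≟K kS = no λ ()
kA ≟K kX = no λ ()
kA ≟K kX̄ = no λ ()
kS ≟K kA = no λ ()
kS ≟K kS = yes refl
kS ≟K kX = no λ ()
kS ≟K kX̄ = no λ ()
kX ≟K kA = no λ ()
kX ≟K kS = no λ ()
kX ≟K kX = yes refl
kX ≟K kX̄ = no λ ()
kX̄ ≟K kA = no λ ()
kX̄ ≟K kS = no λ ()
kX̄ ≟K kX = no λ ()
kX̄ ≟K kX̄ = yes refl

Vertex : ℕ → Set
Vertex n = Fin n × Kind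

_≟V_ : ∀ {n} (v w : Vertex n) → Dec (v ≡ w)
(i , k) ≟V (j , l) with i ≟ j | k ≟K l
... | yes refl | yes refl = yes refl
... | no i≢j   | _        = no λ { refl → i≢j refl }
... | yes _    | no k≢l   = no λ { refl → k≢l refl }

negVertex : ∀ {n} → Literal n → Vertex n
negVertex (h , true)  = (h , kX̄)
negVertex (h , false) = (h , kX)

boxSets : ∀ {n} → Fin n → List (List (Vertex n))
boxSets i =
    ((i , kA) ∷ (i , kS) ∷ (i , kX) ∷ [])
  ∷ ((i , kA) ∷ (i , kS) ∷ (i , kX̄) ∷ [])
  ∷ ((i , kA) ∷ (i , kX) ∷ (i , kX̄) ∷ [])
  ∷ ((i , kS) ∷ (i , kX) ∷ (i , kX̄) ∷ [])
  ∷ []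

clauseSet : ∀ {n} → Clause n → List (Vertex n)
clauseSet (l₁ , l₂ , l₃) =
  (var l₁ , kS) ∷ (var l₂ , kS) ∷ (var l₃ , kS)
  ∷ negVertex l₁ ∷ negVertex l₂ ∷ negVertex l₃ ∷ []

losingSets : ∀ {n} → Formula n → List (List (Vertex n))
losingSets {n} φ = concatMap boxSets (allFin n) ++ Data.List.map clauseSet φ

data Player : Set where
  avoider enforcer : Player

other : Player → Player
other avoider  = enforcer
other enforcer = avoider

data Owner : Set where
  free : Owner
  owned : Player → Owner

Position : ℕ → Set
Position n = Vertex n → Owner

emptyPos : ∀ {n} → Position n
emptyPos _ = free

claim : ∀ {n} → Position n → Vertex n → Player → Position n
claim p v q w with w ≟V v
... | yes _ = owned q
... | no _  = p w

Full : ∀ {n} → Position n → Set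
Full p = ∀ v → p v ≢ free

AvoiderLoses : ∀ {n} → Formula n → Position n → Set
AvoiderLoses φ p = Any (All (λ v → p v ≡ owned avoider)) (losingSets φ)

-- A rule: which moves are legal in a position (beyond being unclaimed).
Rule : ℕ → Set₁
Rule n = Position n → Vertex n → Set

unrestricted : ∀ {n} → Rule n
unrestricted p v = p v ≡ free

orderOK : ∀ {n} → Position n → Vertex n → Set
orderOK p (i , kA)  = Data.Unit.⊤
  where import Data.Unit
orderOK p (i , kX)  = p (i , kA) ≢ free
orderOK p (i , kX̄)  = p (i , kA) ≢ free
orderOK p (i , kS)  = p (i , kX) ≢ free × p (i , kX̄) ≢ free

restricted : ∀ {n} → Rule n
restricted p v = p v ≡ free × orderOK p v

-- Winning (game-tree definition of "player has a winning strategy")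
-- Wins φ R w p t : player w has a winning strategy from position p,
-- player t to move, when moves are governed by rule R.

Outcome : ∀ {n} → Formula n → Position n → Player → Set
Outcome φ p enforcer = AvoiderLoses φ p
Outcome φ p avoider  = ¬ AvoiderLoses φ p

data Wins {n} (φ : Formula n) (R : Rule n) (w : Player)
          : Position n → Player → Set where
  finished : ∀ {p t} → Full p → Outcome φ p w → Wins φ R w p t
  myMove   : ∀ {p} → ¬ Full p → (v : Vertex n) → R p v →
             Wins φ R w (claim p v w) (other w) → Wins φ R w p w
  theirMove : ∀ {p} → ¬ Full p →
             (∀ v → R p v → Wins φ R w (claim p v (other w)) w) →
             Wins φ R w p (other w)

HasWinningStrategy : ∀ {n} → Formula n → Rule n → Player → Set
HasWinningStrategy φ R w = Wins φ R w emptyPos enforcer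

{-# OPTIONS --safe #-}
module Submission where

-- Both games are decided by the satisfiability of φ, by strategies that only ever make orderly
-- moves (a before x and x̄, s after both) while coping with arbitrary moves of the opponent; such a
-- strategy wins under every rule that allows all orderly moves and only claims free vertices.
--
-- If σ satisfies φ, Avoider answers every move of Enforcer inside the same box. She ends with two
-- vertices of each box, and never with s_i together with the negation of the literal that σ makes
-- true; so she owns no triple of a box and no set L_C.
--
-- If φ is unsatisfiable, Enforcer opens a fresh box by taking a_i and answers inside it, so that
-- Avoider ends with s_i and exactly one of x_i, x̄_i. Reading an assignment off her choices, some
-- clause C is false, and she owns all of L_C. If she ever leaves an opened box unanswered, Enforcer
-- takes three vertices of it; as he holds at most one vertex more than her, at the end she holds
-- three vertices of another box.

open import Defs
open import Data.Bool using (Bool; true; false; _∧_; _∨_; _xor_; not; T; if_then_else_)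
open import Data.Bool.ListAction using (any; all)
open import Data.Bool.Properties using (T?) renaming (_≟_ to _≟ᵇ_)
open import Data.Empty using (⊥; ⊥-elim)
open import Data.Fin as Fin using (Fin; punchIn) renaming (_≟_ to _≟ᶠ_)
open import Data.Fin.Properties using (any?; punchInᵢ≢i)
open import Data.Fin.Subset.Properties using (anySubset?)
open import Data.List using (List; []; _∷_; length; filterᵇ; map; concatMap; allFin)
open import Data.List.Relation.Unary.All as All using (All; []; _∷_; all?; lookupAny)
open import Data.List.Relation.Unary.All.Properties using (¬All⇒Any¬)
open import Data.List.Relation.Unary.Any as Any using (Any)
import Data.List.Relation.Unary.All.Properties as Allₚ
import Data.List.Relation.Unary.Any.Properties as Anyₚ
open import Data.Nat using (ℕ; zero; suc; z≤n; _<_; _+_; _≤_; _≡ᵇ_; _≤ᵇ_)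
open import Data.Nat.Induction using (<-wellFounded)
open import Data.Nat.Properties
  using ( +-0-commutativeMonoid; +-commutativeSemigroup; +-assoc; +-comm; +-mono-≤
        ; ≤-reflexive; ≤-trans; n≤1+n; n≮n; ≡ᵇ⇒≡; ≤ᵇ⇒≤; module ≤-Reasoning)
open import Data.Product using (_×_; _,_; proj₁; proj₂; ∃; ∃₂)
open import Data.Sum using (_⊎_; inj₁; inj₂)
open import Data.Unit using (tt)
open import Data.Vec using (Vec; lookup; tabulate)
open import Data.Vec.Functional using (removeAt)
open import Data.Vec.Properties using (lookup∘tabulate)
open import Function using (_∘_; id; const; flip)
open import Function.Bundles using (_⇔_; mk⇔)
open import Induction.WellFounded using (Acc; acc)
open import Relation.Binary.PropositionalEquality
  using (_≡_; _≢_; refl; sym; trans; cong; cong₂; subst; module ≡-Reasoning)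
open import Relation.Nullary using (Dec; yes; no; ¬_)
open import Relation.Nullary.Decidable using (_⊎-dec_)

open import Algebra.Properties.CommutativeSemigroup +-commutativeSemigroup using (xy∙z≈xz∙y)
open import Algebra.Properties.CommutativeMonoid.Sum +-0-commutativeMonoid
  using (sum; sum-remove; sum-cong-≗)

-- Finite statements decided by evaluation

_⇒ᵇ_ : Bool → Bool → Bool
x ⇒ᵇ y = not x ∨ y

infixr 4 _⇒ᵇ_

T-⇒ᵇ : ∀ {x y} → T (x ⇒ᵇ y) → T x → T y
T-⇒ᵇ {true} x⇒y _ = x⇒y

T-not : ∀ {x} → ¬ T x → T (not x)
T-not {false} _  = _
T-not {true}  ¬x = ¬x _

T-not⇒¬T : ∀ {x} → T (not x) → ¬ T x
T-not⇒¬T {false} _ ()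

∧-left : ∀ x {y} → T (x ∧ y) → T x
∧-left true _ = _

∧-right : ∀ x {y} → T (x ∧ y) → T y
∧-right true h = h

∧-intro : ∀ x {y} → T x → T y → T (x ∧ y)
∧-intro true _ h = h

∨-elim : ∀ x {y} → T (x ∨ y) → T x ⊎ T y
∨-elim true  h = inj₁ h
∨-elim false h = inj₂ h

≢⇒xor : ∀ {x y} → x ≢ y → T (x xor y)
≢⇒xor {false} {false} x≢y = x≢y refl
≢⇒xor {false} {true}  _   = _
≢⇒xor {true}  {false} _   = _
≢⇒xor {true}  {true}  x≢y = x≢y refl

record Enumerable (A : Set) : Set where
  field
    every       : (A → Bool) → Bool
    every-sound : ∀ P → T (every P) → ∀ a → T (P a)

open Enumerable {{...}}

instance
  Bool-enumerable : Enumerable Bool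
  Bool-enumerable = record
    { every       = λ P → P true ∧ P false
    ; every-sound = λ { P h true  → ∧-left (P true) h
                      ; P h false → ∧-right (P true) h } }

  Player-enumerable : Enumerable Player
  Player-enumerable = record
    { every       = λ P → P avoider ∧ P enforcer
    ; every-sound = λ { P h avoider  → ∧-left (P avoider) h
                      ; P h enforcer → ∧-right (P avoider) h } }

  Owner-enumerable : Enumerable Owner
  Owner-enumerable = record
    { every       = λ P → P free ∧ every (λ q → P (owned q))
    ; every-sound = λ { P h free      → ∧-left (P free) h
                      ; P h (owned q) → every-sound (λ q → P (owned q)) (∧-right (P free) h) q } }

  Kind-enumerable : Enumerable Kind
  Kind-enumerable = record
    { every       = λ P → P kA ∧ P kS ∧ P kX ∧ P kX̄
    ; every-sound = λ { P h kA → ∧-left (P kA) h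
                      ; P h kS → ∧-left (P kS) (∧-right (P kA) h)
                      ; P h kX → ∧-left (P kX) (∧-right (P kS) (∧-right (P kA) h))
                      ; P h kX̄ → ∧-right (P kX) (∧-right (P kS) (∧-right (P kA) h)) } }

-- The argument tt type-checks exactly when the implication holds in every case.
exhaustive₁ : {A : Set} {{_ : Enumerable A}} (P Q : A → Bool) →
              T (every λ a → P a ⇒ᵇ Q a) → ∀ a → T (P a) → T (Q a)
exhaustive₁ P Q h a = T-⇒ᵇ (every-sound _ h a)

exhaustive₂ : {A B : Set} {{_ : Enumerable A}} {{_ : Enumerable B}} (P Q : A → B → Bool) →
              T (every λ a → every λ b → P a b ⇒ᵇ Q a b) → ∀ a b → T (P a b) → T (Q a b)
exhaustive₂ P Q h a = exhaustive₁ (P a) (Q a) (every-sound _ h a)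

exhaustive₃ : {A B C : Set} {{_ : Enumerable A}} {{_ : Enumerable B}} {{_ : Enumerable C}}
              (P Q : A → B → C → Bool) →
              T (every λ a → every λ b → every λ c → P a b c ⇒ᵇ Q a b c) →
              ∀ a b c → T (P a b c) → T (Q a b c)
exhaustive₃ P Q h a = exhaustive₂ (P a) (Q a) (every-sound _ h a)

data Box : Set where
  ⟨_,_,_,_⟩ : (a s x x̄ : Owner) → Box

_[_] : Box → Kind → Owner
⟨ a , s , x , x̄ ⟩ [ kA ] = a
⟨ a , s , x , x̄ ⟩ [ kS ] = s
⟨ a , s , x , x̄ ⟩ [ kX ] = x
⟨ a , s , x , x̄ ⟩ [ kX̄ ] = x̄

_[_]≔_ : Box → Kind → Owner → Box
⟨ a , s , x , x̄ ⟩ [ kA ]≔ o = ⟨ o , s , x , x̄ ⟩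
⟨ a , s , x , x̄ ⟩ [ kS ]≔ o = ⟨ a , o , x , x̄ ⟩
⟨ a , s , x , x̄ ⟩ [ kX ]≔ o = ⟨ a , s , o , x̄ ⟩
⟨ a , s , x , x̄ ⟩ [ kX̄ ]≔ o = ⟨ a , s , x , o ⟩

instance
  Box-enumerable : Enumerable Box
  Box-enumerable = record
    { every       = λ P → every λ a → every λ s → every λ x → every λ x̄ →
                            P ⟨ a , s , x , x̄ ⟩
    ; every-sound = λ { P h ⟨ a , s , x , x̄ ⟩ →
        every-sound (λ x̄ → P ⟨ a , s , x , x̄ ⟩)
          (every-sound (λ x → every λ x̄ → P ⟨ a , s , x , x̄ ⟩)
            (every-sound (λ s → every λ x → every λ x̄ → P ⟨ a , s , x , x̄ ⟩)
              (every-sound (λ a → every λ s → every λ x → every λ x̄ → P ⟨ a , s , x , x̄ ⟩)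
                h a) s) x) x̄ } }

isFree : Owner → Bool
isFree free      = true
isFree (owned _) = false

owns : Player → Owner → Bool
owns avoider  (owned avoider)  = true
owns enforcer (owned enforcer) = true
owns _        _                = false

slots : Box → List Owner
slots ⟨ a , s , x , x̄ ⟩ = a ∷ s ∷ x ∷ x̄ ∷ []

count : (Owner → Bool) → Box → ℕ
count f b = length (filterᵇ f (slots b))

box-ext : ∀ {b b′} → (∀ k → b [ k ] ≡ b′ [ k ]) → b ≡ b′
box-ext {⟨ _ , _ , _ , _ ⟩} {⟨ _ , _ , _ , _ ⟩} eq
  rewrite eq kA | eq kS | eq kX | eq kX̄ = refl

isFree⇒≡ : ∀ {o} → T (isFree o) → o ≡ free
isFree⇒≡ {free} _ = refl

≡⇒isFree : ∀ {o} → o ≡ free → T (isFree o)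
≡⇒isFree refl = _

orderly : Box → Kind → Bool
orderly b kA = isFree (b [ kA ])
orderly b kX = isFree (b [ kX ]) ∧ not (isFree (b [ kA ]))
orderly b kX̄ = isFree (b [ kX̄ ]) ∧ not (isFree (b [ kA ]))
orderly b kS = isFree (b [ kS ]) ∧ not (isFree (b [ kX ])) ∧ not (isFree (b [ kX̄ ]))

firstOrderly : Box → Kind
firstOrderly b =
  if isFree (b [ kA ]) then kA else
  if isFree (b [ kX ]) then kX else
  if isFree (b [ kX̄ ]) then kX̄ else kS

hasFree : Box → Bool
hasFree b = any isFree (slots b)

firstOrderly-orderly : ∀ b → T (hasFree b) → T (orderly b (firstOrderly b))
firstOrderly-orderly = exhaustive₁ _ _ tt

orderly⇒free : ∀ b k → T (orderly b k) → T (isFree (b [ k ]))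
orderly⇒free = exhaustive₂ _ _ tt

free⇒hasFree : ∀ b k → T (isFree (b [ k ])) → T (hasFree b)
free⇒hasFree = exhaustive₂ _ _ tt

count-free-claim : ∀ q b k → T (isFree (b [ k ])) →
                   T (count isFree b ≡ᵇ suc (count isFree (b [ k ]≔ owned q)))
count-free-claim = exhaustive₃ _ _ tt

count-own-claim : ∀ q b k → T (isFree (b [ k ])) →
                  T (count (owns q) (b [ k ]≔ owned q) ≡ᵇ suc (count (owns q) b))
count-own-claim = exhaustive₃ _ _ tt

count-other-claim : ∀ q b k → T (isFree (b [ k ])) →
                    T (count (owns (other q)) (b [ k ]≔ owned q) ≡ᵇ count (owns (other q)) b)
count-other-claim = exhaustive₃ _ _ tt

sum-update : ∀ {n} (f g : Fin n → ℕ) i {d} → (∀ j → j ≢ i → g j ≡ f j) →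
             g i ≡ d + f i → sum g ≡ d + sum f
sum-update {suc n} f g i {d} agree gᵢ = begin
  sum g                          ≡⟨ sum-remove {i = i} g ⟩
  g i + sum (removeAt g i)       ≡⟨ cong₂ _+_ gᵢ (sum-cong-≗ λ j → agree _ (punchInᵢ≢i i j)) ⟩
  d + f i + sum (removeAt f i)   ≡⟨ +-assoc d (f i) _ ⟩
  d + (f i + sum (removeAt f i)) ≡⟨ cong (d +_) (sum-remove {i = i} f) ⟨
  d + sum f                      ∎
  where open ≡-Reasoning

sum-mono-≤ : ∀ {n} {f g : Fin n → ℕ} → (∀ j → f j ≤ g j) → sum f ≤ sum g
sum-mono-≤ {zero}  _   = z≤n
sum-mono-≤ {suc n} f≤g = +-mono-≤ (f≤g Fin.zero) (sum-mono-≤ (f≤g ∘ Fin.suc))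

sum-gap : ∀ {n} (f g : Fin n → ℕ) i {d} → (∀ j → f j ≤ g j) → f i + d ≤ g i →
          sum f + d ≤ sum g
sum-gap {suc n} f g i {d} f≤g gap = begin
  sum f + d                    ≡⟨ cong (_+ d) (sum-remove {i = i} f) ⟩
  f i + sum (removeAt f i) + d ≡⟨ xy∙z≈xz∙y (f i) _ d ⟩
  f i + d + sum (removeAt f i) ≤⟨ +-mono-≤ gap (sum-mono-≤ (f≤g ∘ punchIn i)) ⟩
  g i + sum (removeAt g i)     ≡⟨ sum-remove {i = i} g ⟨
  sum g                        ∎
  where open ≤-Reasoning

module _ {n : ℕ} where

  boxAt : Position n → Fin n → Box
  boxAt p i = ⟨ p (i , kA) , p (i , kS) , p (i , kX) , p (i , kX̄) ⟩

  boxAt-[] : ∀ p i k → boxAt p i [ k ] ≡ p (i , k)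
  boxAt-[] p i kA = refl
  boxAt-[] p i kS = refl
  boxAt-[] p i kX = refl
  boxAt-[] p i kX̄ = refl

  free-slot : ∀ (p : Position n) i k → p (i , k) ≡ free → T (isFree (boxAt p i [ k ]))
  free-slot p i k eq = ≡⇒isFree (trans (boxAt-[] p i k) eq)

  claim-≡ : ∀ p v q → claim {n} p v q v ≡ owned q
  claim-≡ p v q with v ≟V v
  ... | yes _  = refl
  ... | no v≢v = ⊥-elim (v≢v refl)

  claim-≢ : ∀ p v q {w} → w ≢ v → claim {n} p v q w ≡ p w
  claim-≢ p v q {w} w≢v with w ≟V v
  ... | yes w≡v = ⊥-elim (w≢v w≡v)
  ... | no _    = refl

  claim-slot : ∀ p i k q k′ → claim p (i , k) q (i , k′) ≡ (boxAt p i [ k ]≔ owned q) [ k′ ]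
  claim-slot p i kA q kA = claim-≡ p (i , kA) q
  claim-slot p i kA q kS = claim-≢ p (i , kA) q λ ()
  claim-slot p i kA q kX = claim-≢ p (i , kA) q λ ()
  claim-slot p i kA q kX̄ = claim-≢ p (i , kA) q λ ()
  claim-slot p i kS q kA = claim-≢ p (i , kS) q λ ()
  claim-slot p i kS q kS = claim-≡ p (i , kS) q
  claim-slot p i kS q kX = claim-≢ p (i , kS) q λ ()
  claim-slot p i kS q kX̄ = claim-≢ p (i , kS) q λ ()
  claim-slot p i kX q kA = claim-≢ p (i , kX) q λ ()
  claim-slot p i kX q kS = claim-≢ p (i , kX) q λ ()
  claim-slot p i kX q kX = claim-≡ p (i , kX) q
  claim-slot p i kX q kX̄ = claim-≢ p (i , kX) q λ ()
  claim-slot p i kX̄ q kA = claim-≢ p (i , kX̄) q λ ()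
  claim-slot p i kX̄ q kS = claim-≢ p (i , kX̄) q λ ()
  claim-slot p i kX̄ q kX = claim-≢ p (i , kX̄) q λ ()
  claim-slot p i kX̄ q kX̄ = claim-≡ p (i , kX̄) q

  boxAt-claim-≡ : ∀ p i k q → boxAt (claim p (i , k) q) i ≡ boxAt p i [ k ]≔ owned q
  boxAt-claim-≡ p i k q = box-ext λ k′ →
    trans (boxAt-[] (claim p (i , k) q) i k′) (claim-slot p i k q k′)

  boxAt-claim-≢ : ∀ p i k q {j} → j ≢ i → boxAt (claim p (i , k) q) j ≡ boxAt p j
  boxAt-claim-≢ p i k q {j} j≢i = box-ext λ k′ →
    trans (boxAt-[] (claim p (i , k) q) j k′)
          (trans (claim-≢ p (i , k) q λ eq → j≢i (cong proj₁ eq)) (sym (boxAt-[] p j k′)))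

  here-claim : ∀ (P : Box → Bool) p i k q →
               T (P (boxAt p i [ k ]≔ owned q)) → T (P (boxAt (claim p (i , k) q) i))
  here-claim P p i k q = subst (T ∘ P) (sym (boxAt-claim-≡ p i k q))

  elsewhere-claim : ∀ (P : Box → Bool) p i k q {j} → j ≢ i →
                    T (P (boxAt p j)) → T (P (boxAt (claim p (i , k) q) j))
  elsewhere-claim P p i k q j≢i = subst (T ∘ P) (sym (boxAt-claim-≢ p i k q j≢i))

  claim-boxwise : ∀ (P : Fin n → Box → Bool) p i k q →
                  T (P i (boxAt p i [ k ]≔ owned q)) → (∀ j → j ≢ i → T (P j (boxAt p j))) →
                  ∀ j → T (P j (boxAt (claim p (i , k) q) j))
  claim-boxwise P p i k q here elsewhere j = by-cases (j ≟ᶠ i)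
    where
      by-cases : Dec (j ≡ i) → T (P j (boxAt (claim p (i , k) q) j))
      by-cases (yes refl) = here-claim (P i) p i k q here
      by-cases (no j≢i)   = elsewhere-claim (P j) p i k q j≢i (elsewhere j j≢i)

  claim-transforms : ∀ (P Q : Box → Bool) q →
                     (∀ b k → T (P b ∧ isFree (b [ k ])) → T (Q (b [ k ]≔ owned q))) →
                     (∀ b → T (P b) → T (Q b)) →
                     ∀ p i {j k} → p (j , k) ≡ free →
                     T (P (boxAt p i)) → T (Q (boxAt (claim p (j , k) q) i))
  claim-transforms P Q q claimed-here unclaimed p i {j} {k} v-free Pᵢ = by-cases (i ≟ᶠ j)
    where
      by-cases : Dec (i ≡ j) → T (Q (boxAt (claim p (j , k) q) i))
      by-cases (yes refl) =
        here-claim Q p i k q (claimed-here _ k (∧-intro _ Pᵢ (free-slot p i k v-free)))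
      by-cases (no i≢j)   = elsewhere-claim Q p j k q i≢j (unclaimed _ Pᵢ)

module _ {n : ℕ} where

  total : (Owner → Bool) → Position n → ℕ
  total f p = sum λ i → count f (boxAt p i)

  private
    total-claim : ∀ f (p : Position n) i k q {d} →
                  count f (boxAt p i [ k ]≔ owned q) ≡ d + count f (boxAt p i) →
                  total f (claim p (i , k) q) ≡ d + total f p
    total-claim f p i k q eq = sum-update _ _ i
      (λ j j≢i → cong (count f) (boxAt-claim-≢ p i k q j≢i))
      (trans (cong (count f) (boxAt-claim-≡ p i k q)) eq)

  total-free-claim : ∀ (p : Position n) i k q → p (i , k) ≡ free →
                     total isFree p ≡ suc (total isFree (claim p (i , k) q))
  total-free-claim p i k q eq = sum-update _ _ i
    (λ j j≢i → cong (count isFree) (sym (boxAt-claim-≢ p i k q j≢i)))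
    (trans (≡ᵇ⇒≡ _ _ (count-free-claim q (boxAt p i) k (free-slot p i k eq)))
           (cong (suc ∘ count isFree) (sym (boxAt-claim-≡ p i k q))))

  total-own-claim : ∀ (p : Position n) i k q → p (i , k) ≡ free →
                    total (owns q) (claim p (i , k) q) ≡ suc (total (owns q) p)
  total-own-claim p i k q eq =
    total-claim (owns q) p i k q (≡ᵇ⇒≡ _ _ (count-own-claim q (boxAt p i) k (free-slot p i k eq)))

  total-other-claim : ∀ (p : Position n) i k q → p (i , k) ≡ free →
                      total (owns (other q)) (claim p (i , k) q) ≡ total (owns (other q)) p
  total-other-claim p i k q eq =
    total-claim (owns (other q)) p i k q {0}
      (≡ᵇ⇒≡ _ _ (count-other-claim q (boxAt p i) k (free-slot p i k eq)))

  orderly⇒free-vertex : ∀ p i k → T (orderly (boxAt {n} p i) k) → p (i , k) ≡ free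
  orderly⇒free-vertex p i k o =
    trans (sym (boxAt-[] p i k)) (isFree⇒≡ (orderly⇒free (boxAt p i) k o))

  first-free-vertex : ∀ (p : Position n) i → T (hasFree (boxAt p i)) →
                      p (i , firstOrderly (boxAt p i)) ≡ free
  first-free-vertex p i h = orderly⇒free-vertex p i _ (firstOrderly-orderly (boxAt p i) h)

  full? : (p : Position n) → Full p ⊎ ∃ λ v → p v ≡ free
  full? p with any? (λ i → T? (hasFree (boxAt p i)))
  ... | yes (i , h) = inj₂ (_ , first-free-vertex p i h)
  ... | no ¬h       =
    inj₁ λ { (i , k) eq → ¬h (i , free⇒hasFree (boxAt p i) k (free-slot p i k eq)) }

  full⇒¬hasFree : ∀ {p} → Full p → ∀ i → T (not (hasFree (boxAt {n} p i)))
  full⇒¬hasFree {p} full i = T-not λ h → full _ (first-free-vertex p i h)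

record OrderlyRule {n} (R : Rule n) : Set₁ where
  field
    claims-free    : ∀ {p v} → R p v → p v ≡ free
    allows-orderly : ∀ {p i k} → T (orderly (boxAt p i) k) → R p (i , k)

unrestricted-orderly : ∀ {n} → OrderlyRule {n} unrestricted
unrestricted-orderly = record
  { claims-free    = id
  ; allows-orderly = λ {p} {i} {k} → orderly⇒free-vertex p i k }

restricted-orderly : ∀ {n} → OrderlyRule {n} restricted
restricted-orderly {n} = record
  { claims-free    = proj₁
  ; allows-orderly = λ {p} {i} {k} o → orderly⇒free-vertex p i k o , in-order p i k o }
  where
    claimed : ∀ {o} → T (not (isFree o)) → o ≢ free
    claimed c eq = T-not⇒¬T c (≡⇒isFree eq)

    in-order : ∀ p i k → T (orderly (boxAt {n} p i) k) → orderOK p (i , k)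
    in-order p i kA _ = _
    in-order p i kX o = claimed (∧-right (isFree (p (i , kX))) o)
    in-order p i kX̄ o = claimed (∧-right (isFree (p (i , kX̄))) o)
    in-order p i kS o =
      let xs-claimed = ∧-right (isFree (p (i , kS))) o in
      claimed (∧-left (not (isFree (p (i , kX)))) xs-claimed) ,
      claimed (∧-right (not (isFree (p (i , kX)))) xs-claimed)

wins-exclusive : ∀ {n} {φ : Formula n} {R p t} → Wins φ R avoider p t → Wins φ R enforcer p t → ⊥
wins-exclusive (finished _ o) (finished _ o′)  = o o′
wins-exclusive (finished full _) (myMove ¬full _ _ _) = ¬full full
wins-exclusive (finished full _) (theirMove ¬full _)  = ¬full full
wins-exclusive (myMove ¬full _ _ _) (finished full _) = ¬full full
wins-exclusive (theirMove ¬full _) (finished full _)  = ¬full full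
wins-exclusive (myMove _ v r win) (theirMove _ answers) = wins-exclusive win (answers v r)
wins-exclusive (theirMove _ answers) (myMove _ v r win) = wins-exclusive (answers v r) win

same-winner : ∀ {n} {φ : Formula n} {R₁ R₂} w →
              HasWinningStrategy φ R₁ w → HasWinningStrategy φ R₂ w →
              ∀ w′ → HasWinningStrategy φ R₁ w′ ⇔ HasWinningStrategy φ R₂ w′
same-winner avoider  a₁ a₂ avoider  = mk⇔ (const a₂) (const a₁)
same-winner avoider  a₁ a₂ enforcer = mk⇔ (⊥-elim ∘ wins-exclusive a₁) (⊥-elim ∘ wins-exclusive a₂)
same-winner enforcer e₁ e₂ avoider  =
  mk⇔ (⊥-elim ∘ flip wins-exclusive e₁) (⊥-elim ∘ flip wins-exclusive e₂)
same-winner enforcer e₁ e₂ enforcer = mk⇔ (const e₂) (const e₁)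

record OrderlyStrategy {n} (φ : Formula n) (w : Player) : Set₁ where
  field
    MyTurn TheirTurn : Position n → Set
    myTurn-full    : ∀ {p} → MyTurn p → Full p → Outcome φ p w
    theirTurn-full : ∀ {p} → TheirTurn p → Full p → Outcome φ p w
    move           : ∀ {p v} → MyTurn p → p v ≡ free →
                     ∃₂ λ i k → T (orderly (boxAt p i) k) × TheirTurn (claim p (i , k) w)
    answer         : ∀ {p v} → TheirTurn p → p v ≡ free → MyTurn (claim p v (other w))

module _ {n} {φ : Formula n} {w} (S : OrderlyStrategy φ w) {R : Rule n} (rule : OrderlyRule R) where
  open OrderlyStrategy S
  open OrderlyRule rule

  private
    claim-decreases : ∀ (p : Position n) v q → p v ≡ free →
                      total isFree (claim p v q) < total isFree p
    claim-decreases p (i , k) q v-free = ≤-reflexive (sym (total-free-claim p i k q v-free))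

    on-move  : ∀ p → Acc _<_ (total isFree p) → MyTurn p → Wins φ R w p w
    off-move : ∀ p → Acc _<_ (total isFree p) → TheirTurn p → Wins φ R w p (other w)

    on-move p (acc rec) mine with full? p
    ... | inj₁ full = finished full (myTurn-full mine full)
    ... | inj₂ (v₀ , v₀-free) with move mine v₀-free
    ...   | i , k , o , theirs = myMove (λ full → full v₀ v₀-free) (i , k) (allows-orderly o)
            (off-move _ (rec (claim-decreases p (i , k) w (orderly⇒free-vertex p i k o))) theirs)

    off-move p (acc rec) theirs with full? p
    ... | inj₁ full = finished full (theirTurn-full theirs full)
    ... | inj₂ (v₀ , v₀-free) = theirMove (λ full → full v₀ v₀-free) λ v r →
            on-move _ (rec (claim-decreases p v (other w) (claims-free r)))
                      (answer theirs (claims-free r))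

  wins-on-move : ∀ {p} → MyTurn p → Wins φ R w p w
  wins-on-move {p} = on-move p (<-wellFounded _)

  wins-off-move : ∀ {p} → TheirTurn p → Wins φ R w p (other w)
  wins-off-move {p} = off-move p (<-wellFounded _)

module _ {n : ℕ} where

  Assignment : Set
  Assignment = Vec Bool n

  Satisfies : Assignment → Literal n → Set
  Satisfies σ (h , pol) = lookup σ h ≡ pol

  SatisfiesClause : Assignment → Clause n → Set
  SatisfiesClause σ (ℓ₁ , ℓ₂ , ℓ₃) = Satisfies σ ℓ₁ ⊎ Satisfies σ ℓ₂ ⊎ Satisfies σ ℓ₃

  Satisfiable : Formula n → Set
  Satisfiable φ = ∃ λ σ → All (SatisfiesClause σ) φ

  satisfiesClause? : ∀ σ c → Dec (SatisfiesClause σ c)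
  satisfiesClause? σ ((h₁ , pol₁) , (h₂ , pol₂) , (h₃ , pol₃)) =
    lookup σ h₁ ≟ᵇ pol₁ ⊎-dec lookup σ h₂ ≟ᵇ pol₂ ⊎-dec lookup σ h₃ ≟ᵇ pol₃

  satisfiable? : (φ : Formula n) → Dec (Satisfiable φ)
  satisfiable? φ = anySubset? λ σ → all? (satisfiesClause? σ) φ

literalKind : Bool → Kind
literalKind true  = kX
literalKind false = kX̄

negKind : Bool → Kind
negKind pol = literalKind (not pol)

negVertex-negKind : ∀ {n} (h : Fin n) pol → negVertex (h , pol) ≡ (h , negKind pol)
negVertex-negKind h true  = refl
negVertex-negKind h false = refl

triples : Box → List (List Owner)
triples ⟨ a , s , x , x̄ ⟩ =
  (a ∷ s ∷ x ∷ []) ∷ (a ∷ s ∷ x̄ ∷ []) ∷ (a ∷ x ∷ x̄ ∷ []) ∷ (s ∷ x ∷ x̄ ∷ []) ∷ []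

avoiderTriple : Box → Bool
avoiderTriple b = any (all (owns avoider)) (triples b)

owns-avoider⇒ : ∀ {o} → T (owns avoider o) → o ≡ owned avoider
owns-avoider⇒ {owned avoider} _ = refl

⇒owns-avoider : ∀ {o} → o ≡ owned avoider → T (owns avoider o)
⇒owns-avoider refl = _

AvoiderOwns : ∀ {n} → Position n → Vertex n → Set
AvoiderOwns p v = p v ≡ owned avoider

module _ {n : ℕ} {φ : Formula n} {p : Position n} where

  loss-cases : AvoiderLoses φ p →
               (∃ λ i → T (avoiderTriple (boxAt p i))) ⊎ Any (All (AvoiderOwns p) ∘ clauseSet) φ
  loss-cases loss with Anyₚ.++⁻ (concatMap boxSets (allFin n)) loss
  ... | inj₂ inClause = inj₂ (Anyₚ.map⁻ inClause)
  ... | inj₁ inBox with Any.satisfied (Anyₚ.concatMap⁻ boxSets {xs = allFin n} inBox)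
  ...   | i , ownedSet =
    inj₁ (i , Anyₚ.any⁺ (all (owns avoider)) (Anyₚ.map⁺ {f = map p} (Any.map owned⇒all ownedSet)))
    where
      owned⇒all : ∀ {vs} → All (AvoiderOwns p) vs → T (all (owns avoider) (map p vs))
      owned⇒all = Allₚ.all⁻ _ ∘ Allₚ.map⁺ ∘ All.map ⇒owns-avoider

  triple-loses : ∀ i → T (avoiderTriple (boxAt p i)) → AvoiderLoses φ p
  triple-loses i triple =
    Anyₚ.++⁺ˡ (Anyₚ.concatMap⁺ boxSets (Anyₚ.tabulate⁺ i (Any.map all⇒owned
      (Anyₚ.map⁻ {f = map p} (Anyₚ.any⁻ (all (owns avoider)) (map (map p) (boxSets i)) triple)))))
    where
      all⇒owned : ∀ {vs} → T (all (owns avoider) (map p vs)) → All (AvoiderOwns p) vs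
      all⇒owned = All.map owns-avoider⇒ ∘ Allₚ.map⁻ ∘ Allₚ.all⁺ _ _

  clause-loses : Any (All (AvoiderOwns p) ∘ clauseSet) φ → AvoiderLoses φ p
  clause-loses = Anyₚ.++⁺ʳ (concatMap boxSets (allFin n)) ∘ Anyₚ.map⁺

-- Avoider's strategy when φ is satisfiable

-- t is the truth value of the box's variable; after each of Avoider's replies she owns exactly
-- half of every touched box, and never both s and the vertex of the false literal.
settled : Bool → Box → Bool
settled t b =
    all isFree (slots b)
  ∨ (#A ≡ᵇ 1) ∧ (#E ≡ᵇ 1) ∧ (ownsA kA ∨ ownsE kA ∧ ownsA (literalKind t))
  ∨ (#A ≡ᵇ 2) ∧ (#E ≡ᵇ 2) ∧ not (ownsA kS ∧ ownsA (negKind t))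
  where
    #A = count (owns avoider) b
    #E = count (owns enforcer) b
    ownsA ownsE : Kind → Bool
    ownsA k = owns avoider (b [ k ])
    ownsE k = owns enforcer (b [ k ])

threatened : Bool → Box → Bool
threatened t b =
    (#E ≡ᵇ 1) ∧ (#A ≡ᵇ 0)
  ∨ (#E ≡ᵇ 2) ∧ (#A ≡ᵇ 1) ∧ (ownsA kA ∨ ownsE kA ∧ ownsA (literalKind t))
  where
    #A = count (owns avoider) b
    #E = count (owns enforcer) b
    ownsA ownsE : Kind → Bool
    ownsA k = owns avoider (b [ k ])
    ownsE k = owns enforcer (b [ k ])

avoiderReply : Bool → Box → Kind
avoiderReply t b =
  if owns enforcer (b [ kA ]) ∧ (count (owns avoider) b ≡ᵇ 0) then literalKind t else firstOrderly b

threatened-after-claim : ∀ t b k → T (settled t b ∧ isFree (b [ k ])) →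
                         T (threatened t (b [ k ]≔ owned enforcer))
threatened-after-claim = exhaustive₃ _ _ tt

avoiderReply-orderly : ∀ t b → T (threatened t b) → T (orderly b (avoiderReply t b))
avoiderReply-orderly = exhaustive₂ _ _ tt

settled-after-reply : ∀ t b → T (threatened t b) →
                      T (settled t (b [ avoiderReply t b ]≔ owned avoider))
settled-after-reply = exhaustive₂ _ _ tt

settled-full-no-triple : ∀ t b → T (settled t b ∧ not (hasFree b)) → T (not (avoiderTriple b))
settled-full-no-triple = exhaustive₂ _ _ tt

settled-full-true-literal : ∀ t b → T (settled t b ∧ not (hasFree b)) →
                            T (not (owns avoider (b [ kS ]) ∧ owns avoider (b [ negKind t ])))
settled-full-true-literal = exhaustive₂ _ _ tt

module _ {n} {φ : Formula n} (σ : Assignment) (sat : All (SatisfiesClause σ) φ) where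

  private
    settledAt threatenedAt : Fin n → Box → Bool
    settledAt    = settled ∘ lookup σ
    threatenedAt = threatened ∘ lookup σ

    Settled : Position n → Set
    Settled p = ∀ i → T (settledAt i (boxAt p i))

    Threatened : Position n → Set
    Threatened p = ∃ λ i → T (threatenedAt i (boxAt p i)) ×
                           ∀ j → j ≢ i → T (settledAt j (boxAt p j))

    threaten : ∀ {p v} → Settled p → p v ≡ free → Threatened (claim p v enforcer)
    threaten {p} {i , k} settled-everywhere v-free =
      i , here-claim (threatenedAt i) p i k enforcer
            (threatened-after-claim (lookup σ i) (boxAt p i) k
              (∧-intro _ (settled-everywhere i) (free-slot p i k v-free)))
        , λ j j≢i → elsewhere-claim (settledAt j) p i k enforcer j≢i (settled-everywhere j)

    reply : ∀ {p} → Threatened p →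
            ∃₂ λ i k → T (orderly (boxAt p i) k) × Settled (claim p (i , k) avoider)
    reply {p} (i , threatenedᵢ , settled-others) =
      i , r , avoiderReply-orderly (lookup σ i) (boxAt p i) threatenedᵢ ,
      claim-boxwise settledAt p i r avoider
        (settled-after-reply (lookup σ i) (boxAt p i) threatenedᵢ) settled-others
      where r = avoiderReply (lookup σ i) (boxAt p i)

    threatened-not-full : ∀ {p} → Threatened p → ¬ Full p
    threatened-not-full {p} (i , threatenedᵢ , _) full =
      T-not⇒¬T (full⇒¬hasFree full i) (free⇒hasFree (boxAt p i) r
        (orderly⇒free (boxAt p i) r (avoiderReply-orderly (lookup σ i) (boxAt p i) threatenedᵢ)))
      where r = avoiderReply (lookup σ i) (boxAt p i)

    settled-full : ∀ {p} → Settled p → Full p → ∀ i →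
                   T (settledAt i (boxAt p i) ∧ not (hasFree (boxAt p i)))
    settled-full settled-everywhere full i = ∧-intro _ (settled-everywhere i) (full⇒¬hasFree full i)

    settled-safe : ∀ {p} → Settled p → Full p → ¬ AvoiderLoses φ p
    settled-safe {p} settled-everywhere full loss with loss-cases loss
    ... | inj₁ (i , triple) =
      T-not⇒¬T (settled-full-no-triple (lookup σ i) (boxAt p i)
                 (settled-full settled-everywhere full i)) triple
    ... | inj₂ ownedClause = let satisfied , allOwned = lookupAny sat ownedClause in
      clause-unowned _ satisfied allOwned
      where
        true-literal-unowned : ∀ h pol → lookup σ h ≡ pol →
                               AvoiderOwns p (h , kS) → ¬ AvoiderOwns p (negVertex (h , pol))
        true-literal-unowned h _ refl ownsS ownsNeg =
          T-not⇒¬T (settled-full-true-literal (lookup σ h) (boxAt p h)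
                     (settled-full settled-everywhere full h))
            (∧-intro _ (⇒owns-avoider ownsS)
              (⇒owns-avoider (trans (boxAt-[] p h _)
                (trans (cong p (sym (negVertex-negKind h (lookup σ h)))) ownsNeg))))

        clause-unowned : ∀ c → SatisfiesClause σ c → ¬ All (AvoiderOwns p) (clauseSet c)
        clause-unowned ((h , pol) , _) (inj₁ sat₁) (s₁ ∷ _ ∷ _ ∷ n₁ ∷ _) =
          true-literal-unowned h pol sat₁ s₁ n₁
        clause-unowned (_ , (h , pol) , _) (inj₂ (inj₁ sat₂)) (_ ∷ s₂ ∷ _ ∷ _ ∷ n₂ ∷ _) =
          true-literal-unowned h pol sat₂ s₂ n₂
        clause-unowned (_ , _ , (h , pol)) (inj₂ (inj₂ sat₃)) (_ ∷ _ ∷ s₃ ∷ _ ∷ _ ∷ n₃ ∷ _) =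
          true-literal-unowned h pol sat₃ s₃ n₃

  avoider-strategy : OrderlyStrategy φ avoider
  avoider-strategy = record
    { MyTurn         = Threatened
    ; TheirTurn      = Settled
    ; myTurn-full    = λ threatened full → ⊥-elim (threatened-not-full threatened full)
    ; theirTurn-full = settled-safe
    ; move           = λ threatened _ → reply threatened
    ; answer         = threaten
    }

  avoider-wins : ∀ {R} → OrderlyRule R → HasWinningStrategy φ R avoider
  avoider-wins rule = wins-off-move avoider-strategy rule {emptyPos} λ _ → tt

-- Enforcer's strategy when φ is unsatisfiable

fresh : Box → Bool
fresh b = all isFree (slots b)

done : Box → Bool
done b = ownsE kA ∧ ownsA kS ∧ (ownsA kX ∧ ownsE kX̄ ∨ ownsE kX ∧ ownsA kX̄)
  where
    ownsA ownsE : Kind → Bool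
    ownsA k = owns avoider (b [ k ])
    ownsE k = owns enforcer (b [ k ])

calm : Box → Bool
calm b = fresh b ∨ done b

contested : Box → Bool
contested b = opened ∨ pending
  where
    opened  = owns enforcer (b [ kA ]) ∧ isFree (b [ kS ]) ∧ isFree (b [ kX ]) ∧ isFree (b [ kX̄ ])
    pending = owns enforcer (b [ kA ]) ∧ (count (owns enforcer) b ≡ᵇ 2) ∧ (count isFree b ≡ᵇ 1) ∧
              done (b [ firstOrderly b ]≔ owned avoider)

answered : Box → Bool
answered b = owns enforcer (b [ kA ]) ∧ (count (owns avoider) b ≡ᵇ 1) ∧ (count isFree b ≡ᵇ 2)

enforcerReply : Box → Kind
enforcerReply b = if owns avoider (b [ kX ]) then kX̄ else kX

abandoned : Box → Bool
abandoned b = (count (owns enforcer) b ≡ᵇ 1) ∧ (count (owns avoider) b ≡ᵇ 0)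

doubled : Box → Bool
doubled b = (count (owns enforcer) b ≡ᵇ 2) ∧ (count (owns avoider) b ≡ᵇ 0)

takeable : Box → Bool
takeable b = (2 ≤ᵇ count (owns enforcer) b) ∧ hasFree b

broken : Box → Bool
broken b = 3 ≤ᵇ count (owns enforcer) b

calm-free-fresh : ∀ b k → T (calm b ∧ isFree (b [ k ])) → T (fresh b)
calm-free-fresh = exhaustive₂ _ _ tt

fresh-orderly : ∀ b → T (fresh b) → T (orderly b kA)
fresh-orderly = exhaustive₁ _ _ tt

contested-after-open : ∀ b → T (fresh b) → T (contested (b [ kA ]≔ owned enforcer))
contested-after-open = exhaustive₁ _ _ tt

contested-after-answer : ∀ b k → T (contested b ∧ isFree (b [ k ])) →
                         T (answered (b [ k ]≔ owned avoider) ∨ calm (b [ k ]≔ owned avoider))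
contested-after-answer = exhaustive₂ _ _ tt

contested-unanswered : ∀ b → T (contested b) → T (abandoned b ∨ takeable b)
contested-unanswered = exhaustive₁ _ _ tt

contested-hasFree : ∀ b → T (contested b) → T (hasFree b)
contested-hasFree = exhaustive₁ _ _ tt

enforcerReply-orderly : ∀ b → T (answered b) → T (orderly b (enforcerReply b))
enforcerReply-orderly = exhaustive₁ _ _ tt

contested-after-reply : ∀ b → T (answered b) → T (contested (b [ enforcerReply b ]≔ owned enforcer))
contested-after-reply = exhaustive₁ _ _ tt

abandoned-hasFree : ∀ b → T (abandoned b) → T (hasFree b)
abandoned-hasFree = exhaustive₁ _ _ tt

doubled-after-take : ∀ b → T (abandoned b) → T (doubled (b [ firstOrderly b ]≔ owned enforcer))
doubled-after-take = exhaustive₁ _ _ tt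

takeable-after-claim : ∀ b k → T (doubled b ∧ isFree (b [ k ])) → T (takeable (b [ k ]≔ owned avoider))
takeable-after-claim = exhaustive₂ _ _ tt

doubled-takeable : ∀ b → T (doubled b) → T (takeable b)
doubled-takeable = exhaustive₁ _ _ tt

broken-after-take : ∀ b → T (takeable b) → T (broken (b [ firstOrderly b ]≔ owned enforcer))
broken-after-take = exhaustive₁ _ _ tt

broken-after-claim : ∀ q b k → T (broken b ∧ isFree (b [ k ])) → T (broken (b [ k ]≔ owned q))
broken-after-claim = exhaustive₃ _ _ tt

calm-full-done : ∀ b → T (calm b ∧ not (hasFree b)) → T (done b)
calm-full-done = exhaustive₁ _ _ tt

done-owns-s : ∀ b → T (done b) → T (owns avoider (b [ kS ]))
done-owns-s = exhaustive₁ _ _ tt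

done-owns-negation : ∀ pol b → T (done b ∧ (owns avoider (b [ kX ]) xor pol)) →
                     T (owns avoider (b [ negKind pol ]))
done-owns-negation = exhaustive₂ _ _ tt

full-balanced : ∀ b → T (not (hasFree b) ∧ not (avoiderTriple b)) →
                T (count (owns avoider) b ≤ᵇ count (owns enforcer) b)
full-balanced = exhaustive₁ _ _ tt

full-broken-surplus : ∀ b → T (not (hasFree b) ∧ not (avoiderTriple b) ∧ broken b) →
                      T (count (owns avoider) b + 2 ≤ᵇ count (owns enforcer) b)
full-broken-surplus = exhaustive₁ _ _ tt

#A #E : ∀ {n} → Position n → ℕ
#A = total (owns avoider)
#E = total (owns enforcer)

module _ {n} {φ : Formula n} where

  private
    unfinished : ∀ {p : Position n} i → Full p → ¬ T (hasFree (boxAt p i))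
    unfinished i full = T-not⇒¬T (full⇒¬hasFree full i)

  pigeonhole : ∀ {p} → Full p → ∀ i → T (broken (boxAt p i)) → #E p ≤ suc (#A p) → AvoiderLoses φ p
  pigeonhole {p} full i brokenᵢ bound with any? (λ j → T? (avoiderTriple (boxAt p j)))
  ... | yes (j , triple) = triple-loses j triple
  ... | no ¬triple = ⊥-elim (n≮n (suc (#A p)) (begin-strict
      suc (#A p)     <⟨ ≤-reflexive (+-comm 2 (#A p)) ⟩
      #A p + 2       ≤⟨ sum-gap _ _ i balanced surplus ⟩
      #E p           ≤⟨ bound ⟩
      suc (#A p)     ∎))
    where
      open ≤-Reasoning
      no-triple : ∀ j → T (not (avoiderTriple (boxAt p j)))
      no-triple j = T-not λ triple → ¬triple (j , triple)

      balanced : ∀ j → count (owns avoider) (boxAt p j) ≤ count (owns enforcer) (boxAt p j)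
      balanced j = ≤ᵇ⇒≤ _ _ (full-balanced (boxAt p j) (∧-intro _ (full⇒¬hasFree full j) (no-triple j)))

      surplus : count (owns avoider) (boxAt p i) + 2 ≤ count (owns enforcer) (boxAt p i)
      surplus = ≤ᵇ⇒≤ _ _ (full-broken-surplus (boxAt p i)
        (∧-intro _ (full⇒¬hasFree full i) (∧-intro _ (no-triple i) brokenᵢ)))

  module _ (unsat : ¬ Satisfiable φ) where

    calm-full-loses : ∀ {p} → Full p → (∀ j → T (calm (boxAt p j))) → AvoiderLoses φ p
    calm-full-loses {p} full calm-everywhere =
      clause-loses (Any.map clause-owned (¬All⇒Any¬ (satisfiesClause? σ) φ λ sat → unsat (σ , sat)))
      where
        σ : Assignment
        σ = tabulate λ h → owns avoider (p (h , kX))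

        done-at : ∀ h → T (done (boxAt p h))
        done-at h = calm-full-done (boxAt p h) (∧-intro _ (calm-everywhere h) (full⇒¬hasFree full h))

        owns-s : ∀ h → AvoiderOwns p (h , kS)
        owns-s h = owns-avoider⇒ (done-owns-s (boxAt p h) (done-at h))

        owns-negation : ∀ h pol → ¬ Satisfies σ (h , pol) → AvoiderOwns p (negVertex (h , pol))
        owns-negation h pol unsatisfied = begin
          p (negVertex (h , pol))        ≡⟨ cong p (negVertex-negKind h pol) ⟩
          p (h , negKind pol)            ≡⟨ boxAt-[] p h (negKind pol) ⟨
          boxAt p h [ negKind pol ]      ≡⟨ owns-avoider⇒ (done-owns-negation pol (boxAt p h)
                                              (∧-intro _ (done-at h) (≢⇒xor λ eq →
                                                unsatisfied (trans (lookup∘tabulate _ h) eq)))) ⟩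
          owned avoider                  ∎
          where open ≡-Reasoning

        clause-owned : ∀ {c} → ¬ SatisfiesClause σ c → All (AvoiderOwns p) (clauseSet c)
        clause-owned {(h₁ , pol₁) , (h₂ , pol₂) , (h₃ , pol₃)} unsatisfied =
          owns-s h₁ ∷ owns-s h₂ ∷ owns-s h₃ ∷
          owns-negation h₁ pol₁ (unsatisfied ∘ inj₁) ∷
          owns-negation h₂ pol₂ (unsatisfied ∘ inj₂ ∘ inj₁) ∷
          owns-negation h₃ pol₃ (unsatisfied ∘ inj₂ ∘ inj₂) ∷ []

    private
      CalmExcept : Fin n → Position n → Set
      CalmExcept i p = ∀ j → j ≢ i → T (calm (boxAt p j))

      data EnforcerToMove (p : Position n) : Set where
        some-broken    : ∀ i → T (broken (boxAt p i)) → EnforcerToMove p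
        some-takeable  : ∀ i → T (takeable (boxAt p i)) → EnforcerToMove p
        some-abandoned : ∀ i → T (abandoned (boxAt p i)) → EnforcerToMove p
        one-answered   : ∀ i → T (answered (boxAt p i)) → CalmExcept i p → EnforcerToMove p
        all-calm       : (∀ j → T (calm (boxAt p j))) → EnforcerToMove p

      data AvoiderToMove (p : Position n) : Set where
        some-broken   : ∀ i → T (broken (boxAt p i)) → AvoiderToMove p
        some-doubled  : ∀ i → T (doubled (boxAt p i)) → AvoiderToMove p
        one-contested : ∀ i → T (contested (boxAt p i)) → CalmExcept i p → AvoiderToMove p

      calm-elsewhere : ∀ {p i k q} → CalmExcept i p → CalmExcept i (claim p (i , k) q)
      calm-elsewhere {p} {i} {k} {q} calm-others j j≢i =
        elsewhere-claim calm p i k q j≢i (calm-others j j≢i)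

      enforcer-move : ∀ {p v} → EnforcerToMove p → p v ≡ free →
                      ∃₂ λ i k → T (orderly (boxAt p i) k) × AvoiderToMove (claim p (i , k) enforcer)
      enforcer-move {p} {i₀ , k₀} (some-broken i brokenᵢ) v-free =
        i₀ , firstOrderly b₀ , o , some-broken i
          (claim-transforms broken broken enforcer (broken-after-claim enforcer) (λ _ → id)
            p i (orderly⇒free-vertex p i₀ _ o) brokenᵢ)
        where
          b₀ = boxAt p i₀
          o  = firstOrderly-orderly b₀ (free⇒hasFree b₀ k₀ (free-slot p i₀ k₀ v-free))
      enforcer-move {p} (some-takeable i takeableᵢ) _ =
        i , firstOrderly (boxAt p i) , firstOrderly-orderly (boxAt p i) (∧-right _ takeableᵢ) ,
        some-broken i (here-claim broken p i _ enforcer (broken-after-take (boxAt p i) takeableᵢ))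
      enforcer-move {p} (some-abandoned i abandonedᵢ) _ =
        i , firstOrderly (boxAt p i) ,
        firstOrderly-orderly (boxAt p i) (abandoned-hasFree (boxAt p i) abandonedᵢ) ,
        some-doubled i (here-claim doubled p i _ enforcer (doubled-after-take (boxAt p i) abandonedᵢ))
      enforcer-move {p} (one-answered i answeredᵢ calm-others) _ =
        i , enforcerReply (boxAt p i) , enforcerReply-orderly (boxAt p i) answeredᵢ ,
        one-contested i
          (here-claim contested p i _ enforcer (contested-after-reply (boxAt p i) answeredᵢ))
          (calm-elsewhere calm-others)
      enforcer-move {p} {i₀ , k₀} (all-calm calm-everywhere) v-free =
        i₀ , kA , fresh-orderly b₀ fresh₀ ,
        one-contested i₀ (here-claim contested p i₀ kA enforcer (contested-after-open b₀ fresh₀))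
          (calm-elsewhere λ j _ → calm-everywhere j)
        where
          b₀ = boxAt p i₀
          fresh₀ = calm-free-fresh b₀ k₀ (∧-intro _ (calm-everywhere i₀) (free-slot p i₀ k₀ v-free))

      enforcer-answer : ∀ {p v} → AvoiderToMove p → p v ≡ free → EnforcerToMove (claim p v avoider)
      enforcer-answer {p} (some-broken i brokenᵢ) v-free =
        some-broken i (claim-transforms broken broken avoider (broken-after-claim avoider) (λ _ → id)
                         p i v-free brokenᵢ)
      enforcer-answer {p} (some-doubled i doubledᵢ) v-free =
        some-takeable i (claim-transforms doubled takeable avoider takeable-after-claim doubled-takeable
                           p i v-free doubledᵢ)
      enforcer-answer {p} {j , k} (one-contested i contestedᵢ calm-others) v-free = by-cases (j ≟ᶠ i)
        where
          by-cases : Dec (j ≡ i) → EnforcerToMove (claim p (j , k) avoider)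
          by-cases (yes refl) with ∨-elim _ (contested-after-answer (boxAt p i) k
                                               (∧-intro _ contestedᵢ (free-slot p i k v-free)))
          ... | inj₁ answeredᵢ = one-answered i (here-claim answered p i k avoider answeredᵢ)
                                   (calm-elsewhere calm-others)
          ... | inj₂ calmᵢ     = all-calm (claim-boxwise (λ _ → calm) p i k avoider calmᵢ calm-others)
          by-cases (no j≢i) with ∨-elim _ (contested-unanswered (boxAt p i) contestedᵢ)
          ... | inj₁ abandonedᵢ =
            some-abandoned i (elsewhere-claim abandoned p j k avoider (j≢i ∘ sym) abandonedᵢ)
          ... | inj₂ takeableᵢ  =
            some-takeable i (elsewhere-claim takeable p j k avoider (j≢i ∘ sym) takeableᵢ)

      enforcer-done : ∀ {p} → EnforcerToMove p → #A p ≡ #E p → Full p → AvoiderLoses φ p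
      enforcer-done {p} (some-broken i brokenᵢ) balanced full =
        pigeonhole full i brokenᵢ (≤-trans (≤-reflexive (sym balanced)) (n≤1+n _))
      enforcer-done {p} (some-takeable i takeableᵢ) _ full =
        ⊥-elim (unfinished i full (∧-right _ takeableᵢ))
      enforcer-done {p} (some-abandoned i abandonedᵢ) _ full =
        ⊥-elim (unfinished i full (abandoned-hasFree (boxAt p i) abandonedᵢ))
      enforcer-done {p} (one-answered i answeredᵢ _) _ full =
        ⊥-elim (unfinished i full (free⇒hasFree (boxAt p i) r
          (orderly⇒free (boxAt p i) r (enforcerReply-orderly (boxAt p i) answeredᵢ))))
        where r = enforcerReply (boxAt p i)
      enforcer-done (all-calm calm-everywhere) _ full = calm-full-loses full calm-everywhere

      avoider-done : ∀ {p} → AvoiderToMove p → #E p ≡ suc (#A p) → Full p → AvoiderLoses φ p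
      avoider-done (some-broken i brokenᵢ) ahead full = pigeonhole full i brokenᵢ (≤-reflexive ahead)
      avoider-done {p} (some-doubled i doubledᵢ) _ full =
        ⊥-elim (unfinished i full (∧-right _ (doubled-takeable (boxAt p i) doubledᵢ)))
      avoider-done {p} (one-contested i contestedᵢ _) _ full =
        ⊥-elim (unfinished i full (contested-hasFree (boxAt p i) contestedᵢ))

      EnforcerTurn AvoiderTurn : Position n → Set
      EnforcerTurn p = EnforcerToMove p × #A p ≡ #E p
      AvoiderTurn  p = AvoiderToMove p × #E p ≡ suc (#A p)

      move : ∀ {p v} → EnforcerTurn p → p v ≡ free →
             ∃₂ λ i k → T (orderly (boxAt p i) k) × AvoiderTurn (claim p (i , k) enforcer)
      move {p} (state , balanced) v-free with enforcer-move state v-free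
      ... | i , k , o , state′ = i , k , o , state′ , (begin
        #E (claim p (i , k) enforcer)       ≡⟨ total-own-claim p i k enforcer k-free ⟩
        suc (#E p)                          ≡⟨ cong suc balanced ⟨
        suc (#A p)                          ≡⟨ cong suc (total-other-claim p i k enforcer k-free) ⟨
        suc (#A (claim p (i , k) enforcer)) ∎)
        where
          open ≡-Reasoning
          k-free = orderly⇒free-vertex p i k o

      answer : ∀ {p v} → AvoiderTurn p → p v ≡ free → EnforcerTurn (claim p v avoider)
      answer {p} {i , k} (state , ahead) v-free = enforcer-answer state v-free , (begin
        #A (claim p (i , k) avoider) ≡⟨ total-own-claim p i k avoider v-free ⟩
        suc (#A p)                   ≡⟨ ahead ⟨
        #E p                         ≡⟨ total-other-claim p i k avoider v-free ⟨
        #E (claim p (i , k) avoider) ∎)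
        where open ≡-Reasoning

    enforcer-strategy : OrderlyStrategy φ enforcer
    enforcer-strategy = record
      { MyTurn         = EnforcerTurn
      ; TheirTurn      = AvoiderTurn
      ; myTurn-full    = λ (state , balanced) → enforcer-done state balanced
      ; theirTurn-full = λ (state , ahead) → avoider-done state ahead
      ; move           = move
      ; answer         = answer
      }

    enforcer-wins : ∀ {R} → OrderlyRule R → HasWinningStrategy φ R enforcer
    enforcer-wins rule = wins-on-move enforcer-strategy rule (all-calm (λ _ → tt) , refl)

-- Clauses need not use distinct variables.
lemma6 : (n : ℕ) (φ : Formula n) → All DistinctVars φ →
         (w : Player) →
         HasWinningStrategy φ restricted w ⇔ HasWinningStrategy φ unrestricted w
lemma6 n φ _ with satisfiable? φ
... | yes (σ , sat) =
  same-winner avoider (avoider-wins σ sat restricted-orderly) (avoider-wins σ sat unrestricted-orderly)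
... | no unsat =
  same-winner enforcer (enforcer-wins unsat restricted-orderly) (enforcer-wins unsat unrestricted-orderly)
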